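{- Let $d \geq 2$ and $n_1,\dots,n_d \geq 1$ be integers, and let $G_1$ and $G_2$ be graphs with non-empty vertex sets and maximum degrees $\Delta_1$ and $\Delta_2$ respectively. Then $K_{n_1,\dots,n_d}$ is (isomorphic to) a subgraph of $G_1 \square G_2$ if and only if at least one of the following holds: (i) $K_{n_1,\dots,n_d}$ is a subgraph of $G_1$ or of $G_2$; (ii) $d=2$, $(n_1,n_2)=(2,2)$, and $K_2$ is a subgraph of both $G_1$ and $G_2$; (iii) $d=2$, $(n_1,n_2)=(1,s)$ for some integer $s\geq 1$, and $\Delta_1+\Delta_2\geq s$.
   Context: All graphs are finite and simple. The cartesian product $G_1 \square G_2$ has vertex set $V(G_1)\times V(G_2)$, with $(a,v)(b,u)$ an edge iff either $ab\in E(G_1)$ and $u=v$, or $uv\in E(G_2)$ and $a=b$. $K_{n_1,\dots,n_d}$ denotes the complete $d$-partite graph with parts of sizes $n_1,\dots,n_d$. -}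

module Defs where

open import Data.Nat using (ℕ; zero; suc; _+_; _*_; _⊔_)
open import Data.Bool using (Bool; true; false; _∧_; _∨_; if_then_else_; not)
open import Data.Fin using (Fin; zero; suc; splitAt; remQuot)
open import Data.Fin.Properties using () renaming (_≟_ to _≟F_)
open import Data.List using (List; []; _∷_; map; foldr; length)
open import Data.Nat.ListAction using (sum)
open import Data.List.Base using (allFin)
open import Data.Sum using (inj₁; inj₂)
open import Data.Product using (_×_; _,_; Σ; ∃)
open import Relation.Binary.PropositionalEquality as ≡ using (_≡_; refl; cong)
open import Relation.Nullary using (yes; no)
open import Data.Empty using (⊥-elim)
open import Relation.Nullary.Decidable using (⌊_⌋; ¬?)
open import Function.Definitions using (Injective)

record Graph : Set where
  field
    order : ℕ
    adj   : Fin order → Fin order → Bool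
    sym   : ∀ x y → adj x y ≡ adj y x
    irrefl : ∀ x → adj x x ≡ false
open Graph public

degree : (G : Graph) → Fin (order G) → ℕ
degree G v = sum (map (λ u → if adj G v u then 1 else 0) (allFin (order G)))

maxDegree : Graph → ℕ
maxDegree G = foldr _⊔_ 0 (map (degree G) (allFin (order G)))

_⊆G_ : Graph → Graph → Set
H ⊆G G = Σ (Fin (order H) → Fin (order G)) λ f →
  Injective _≡_ _≡_ f × (∀ x y → adj H x y ≡ true → adj G (f x) (f y) ≡ true)

eqF : ∀ {n} → Fin n → Fin n → Bool
eqF x y = ⌊ x ≟F y ⌋

eqF-sym : ∀ {n} (x y : Fin n) → eqF x y ≡ eqF y x
eqF-sym x y with x ≟F y | y ≟F x
... | yes _ | yes _ = refl
... | no _  | no _  = refl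
... | yes p | no q  = ⊥-elim (q (≡.sym p))
... | no p  | yes q = ⊥-elim (p (≡.sym q))

eqF-refl : ∀ {n} (x : Fin n) → eqF x x ≡ true
eqF-refl x with x ≟F x
... | yes _ = refl
... | no q  = ⊥-elim (q refl)

adjPair : (G₁ G₂ : Graph) → Fin (order G₁) × Fin (order G₂) → Fin (order G₁) × Fin (order G₂) → Bool
adjPair G₁ G₂ (a , v) (b , u) = (adj G₁ a b ∧ eqF v u) ∨ (adj G₂ v u ∧ eqF a b)

adjPair-sym : (G₁ G₂ : Graph) → ∀ p q → adjPair G₁ G₂ p q ≡ adjPair G₁ G₂ q p
adjPair-sym G₁ G₂ (a , v) (b , u) rewrite sym G₁ a b | sym G₂ v u | eqF-sym v u | eqF-sym a b = refl

adjPair-irrefl : (G₁ G₂ : Graph) → ∀ p → adjPair G₁ G₂ p p ≡ false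
adjPair-irrefl G₁ G₂ (a , v) rewrite irrefl G₁ a | irrefl G₂ v = refl

-- vertex x of the product corresponds to the pair remQuot x = (a , v), a ∈ V(G₁), v ∈ V(G₂)
□adj : (G₁ G₂ : Graph) → Fin (order G₁ * order G₂) → Fin (order G₁ * order G₂) → Bool
□adj G₁ G₂ x y = adjPair G₁ G₂ (remQuot (order G₂) x) (remQuot (order G₂) y)

_□_ : Graph → Graph → Graph
G₁ □ G₂ = record
  { order = order G₁ * order G₂
  ; adj = □adj G₁ G₂
  ; sym = λ x y → adjPair-sym G₁ G₂ (remQuot (order G₂) x) (remQuot (order G₂) y)
  ; irrefl = λ x → adjPair-irrefl G₁ G₂ (remQuot (order G₂) x) }

-- Complete multipartite graph K_{n₁,…,n_d}; parts listed as ns = n₁ ∷ … ∷ n_d.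
-- Vertices Fin (n₁ + … + n_d), the first n₁ in part 0, the next n₂ in part 1, …

part : (ns : List ℕ) → Fin (sum ns) → Fin (length ns)
part [] ()
part (n ∷ ns) x with splitAt n x
... | inj₁ _ = zero
... | inj₂ j = suc (part ns j)

Kadj : (ns : List ℕ) → Fin (sum ns) → Fin (sum ns) → Bool
Kadj ns x y = not (eqF (part ns x) (part ns y))

Ksym : (ns : List ℕ) → ∀ x y → Kadj ns x y ≡ Kadj ns y x
Ksym ns x y = cong not (eqF-sym (part ns x) (part ns y))

Kirrefl : (ns : List ℕ) → ∀ x → Kadj ns x x ≡ false
Kirrefl ns x = cong not (eqF-refl (part ns x))

K : List ℕ → Graph
K ns = record { order = sum ns ; adj = Kadj ns ; sym = Ksym ns ; irrefl = Kirrefl ns }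

module Submission where

-- Every edge of G₁ □ G₂ changes exactly one coordinate. Hence if two distinct vertices of a copy of
-- K ns lie in one layer G₁ × {v}, so does each common neighbour of theirs: otherwise it would share
-- its G₁-coordinate with both, and the two would coincide. In a complete multipartite graph this
-- spreads to every vertex when there are three parts (an edge lies in a layer or in a column), or
-- when two parts have two vertices each and some part has a pair in one layer or one column; the
-- copy then lies in G₁ or in G₂. Otherwise two vertices (a , v), (b , u) of a part have only the
-- corners (a , u), (b , v) as possible common neighbours, so both parts have size 2 and the corners
-- witness edges of G₁ and G₂. A part of size 1 is the centre of a star, whose size is at most the
-- degree of the centre in the product, hence at most Δ₁ + Δ₂.

open import Defs
open import Data.Bool using (Bool; true; false; if_then_else_; _∧_; _∨_)
open import Data.Bool.Properties using (∨-comm)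
open import Data.Fin
  using (Fin; zero; suc; _↑ˡ_; _↑ʳ_; splitAt; join; remQuot; combine; inject≤; fromℕ<)
open import Data.Fin.Properties
  using (suc-injective; ↑ˡ-injective; ↑ʳ-injective; splitAt-↑ˡ; splitAt-↑ʳ; splitAt-join;
         join-splitAt; remQuot-combine; combine-remQuot; inject≤-injective; injective⇒≤)
  renaming (_≟_ to _≟F_)
open import Data.List using (List; []; _∷_; length; lookup; map; foldr; tabulate)
open import Data.List.Membership.Propositional using (_∈_)
open import Data.List.Membership.Propositional.Properties using (∈-map⁺; ∈-map⁻; ∈-allFin)
open import Data.List.Properties using (map-tabulate)
open import Data.List.Relation.Unary.All using (All; _∷_)
open import Data.List.Relation.Unary.Any using (here; there)
open import Data.Nat using (ℕ; zero; suc; _+_; _⊔_; _≤_; z≤n; s≤s)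
open import Data.Nat.ListAction using (sum)
open import Data.Nat.Properties using (≤-trans; m≤m⊔n; m≤n⊔m; ⊔-sel; ⊔-identityʳ; +-mono-≤)
open import Data.Product using (Σ; ∃; ∃₂; _×_; _,_; proj₁; proj₂; uncurry; swap)
open import Data.Sum using (_⊎_; inj₁; inj₂; [_,_]′)
open import Function using (_∘_; const; _⇔_; mk⇔; Equivalence)
open import Function.Definitions using (Injective)
open import Relation.Binary.PropositionalEquality as ≡
  using (_≡_; _≢_; refl; trans; cong; cong₂; subst; subst₂)
open import Relation.Nullary using (yes; no)
open import Relation.Nullary.Negation using (contradiction)

retraction⇒injective : ∀ {A B : Set} {f : A → B} (g : B → A) → (∀ x → g (f x) ≡ x) →
  Injective _≡_ _≡_ f
retraction⇒injective g gf {x} {y} eq = trans (≡.sym (gf x)) (trans (cong g eq) (gf y))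

splitAt-injective : ∀ m {n} → Injective _≡_ _≡_ (splitAt m {n})
splitAt-injective m {n} = retraction⇒injective (join m n) (join-splitAt m n)

join-injective : ∀ m n → Injective _≡_ _≡_ (join m n)
join-injective m n = retraction⇒injective (splitAt m) (splitAt-join m n)

≤2-of-two-values : ∀ {s} {X : Set} {x y : X} (f : Fin s → X) → Injective _≡_ _≡_ f →
  (∀ i → f i ≡ x ⊎ f i ≡ y) → s ≤ 2
≤2-of-two-values {x = x} {y} f f-injective f∈ = injective⇒≤ side-injective
  where
  side : Fin _ → Fin 2
  side i = [ const zero , const (suc zero) ]′ (f∈ i)

  same-side : ∀ {i j} (ci : f i ≡ x ⊎ f i ≡ y) (cj : f j ≡ x ⊎ f j ≡ y) →
    [ const zero , const (suc zero) ]′ ci ≡ [ const zero , const (suc zero) ]′ cj → f i ≡ f j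
  same-side (inj₁ fi) (inj₁ fj) _ = trans fi (≡.sym fj)
  same-side (inj₂ fi) (inj₂ fj) _ = trans fi (≡.sym fj)
  same-side (inj₁ _)  (inj₂ _)  ()
  same-side (inj₂ _)  (inj₁ _)  ()

  side-injective : Injective _≡_ _≡_ side
  side-injective eq = f-injective (same-side (f∈ _) (f∈ _) eq)

adjacent⇒≢ : ∀ {X : Set} (R : X → X → Bool) → (∀ x → R x x ≡ false) →
  ∀ {x y} → R x y ≡ true → x ≢ y
adjacent⇒≢ R R-irrefl {x} e refl with trans (≡.sym e) (R-irrefl x)
... | ()

count : ∀ {n} → (Fin n → Bool) → ℕ
count P = sum (tabulate (λ u → if P u then 1 else 0))

enumerate : ∀ {n} (P : Fin n → Bool) → Fin (count P) → Fin n
enumerate {suc n} P i with P zero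
enumerate {suc n} P zero    | true  = zero
enumerate {suc n} P (suc i) | true  = suc (enumerate (P ∘ suc) i)
enumerate {suc n} P i       | false = suc (enumerate (P ∘ suc) i)

enumerate-sound : ∀ {n} (P : Fin n → Bool) i → P (enumerate P i) ≡ true
enumerate-sound {suc n} P i with P zero in P0
enumerate-sound {suc n} P zero    | true  = P0
enumerate-sound {suc n} P (suc i) | true  = enumerate-sound (P ∘ suc) i
enumerate-sound {suc n} P i       | false = enumerate-sound (P ∘ suc) i

enumerate-injective : ∀ {n} (P : Fin n → Bool) → Injective _≡_ _≡_ (enumerate P)
enumerate-injective {suc n} P {i} {j} eq with P zero
enumerate-injective {suc n} P {zero}  {zero}  eq | true  = refl
enumerate-injective {suc n} P {suc i} {suc j} eq | true  =
  cong suc (enumerate-injective (P ∘ suc) (suc-injective eq))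
enumerate-injective {suc n} P {i}     {j}     eq | false =
  enumerate-injective (P ∘ suc) (suc-injective eq)

index : ∀ {n} (P : Fin n → Bool) u → P u ≡ true → Fin (count P)
index {suc n} P zero p with P zero
index {suc n} P zero refl | true = zero
index {suc n} P (suc u) p with P zero
... | true  = suc (index (P ∘ suc) u p)
... | false = index (P ∘ suc) u p

enumerate-index : ∀ {n} (P : Fin n → Bool) u (p : P u ≡ true) →
  enumerate P (index P u p) ≡ u
enumerate-index {suc n} P zero p with P zero
enumerate-index {suc n} P zero refl | true = refl
enumerate-index {suc n} P (suc u) p with P zero
... | true  = cong suc (enumerate-index (P ∘ suc) u p)
... | false = cong suc (enumerate-index (P ∘ suc) u p)

Vertex : Graph → Set
Vertex G = Fin (order G)

∈⇒≤foldr-⊔ : ∀ {m} {xs : List ℕ} → m ∈ xs → m ≤ foldr _⊔_ 0 xs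
∈⇒≤foldr-⊔ {xs = x ∷ xs} (here refl)  = m≤m⊔n x _
∈⇒≤foldr-⊔ {xs = x ∷ xs} (there m∈xs) = ≤-trans (∈⇒≤foldr-⊔ m∈xs) (m≤n⊔m x _)

foldr-⊔-∈ : ∀ x xs → foldr _⊔_ 0 (x ∷ xs) ∈ x ∷ xs
foldr-⊔-∈ x [] = here (⊔-identityʳ x)
foldr-⊔-∈ x (y ∷ ys) with ⊔-sel x (foldr _⊔_ 0 (y ∷ ys))
... | inj₁ eq = here eq
... | inj₂ eq = there (subst (_∈ y ∷ ys) (≡.sym eq) (foldr-⊔-∈ y ys))

degree≡count : ∀ G v → degree G v ≡ count (adj G v)
degree≡count G v = cong sum (map-tabulate (λ u → u) (λ u → if adj G v u then 1 else 0))

degree≤maxDegree : ∀ G v → degree G v ≤ maxDegree G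
degree≤maxDegree G v = ∈⇒≤foldr-⊔ (∈-map⁺ (degree G) (∈-allFin v))

maxDegree-attained : ∀ G → 1 ≤ order G → ∃ λ v → maxDegree G ≡ degree G v
maxDegree-attained G@record { order = suc n } _
  with ∈-map⁻ (degree G) (foldr-⊔-∈ (degree G zero) (map (degree G) (tabulate suc)))
... | v , _ , eq = v , eq

-- H ⊆G G is Embedding H (adj G); copies of H in G₁ □ G₂ are handled as
-- Embedding H (adjPair G₁ G₂), see ⊆□⇔.
Embedding : Graph → {X : Set} → (X → X → Bool) → Set
Embedding H {X} R = Σ (Vertex H → X) λ f →
  Injective _≡_ _≡_ f × (∀ x y → adj H x y ≡ true → R (f x) (f y) ≡ true)

member : ∀ ns (i : Fin (length ns)) → Fin (lookup ns i) → Fin (sum ns)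
member (n ∷ ns) zero    k = k ↑ˡ sum ns
member (n ∷ ns) (suc i) k = n ↑ʳ member ns i k

member-injective : ∀ ns i → Injective _≡_ _≡_ (member ns i)
member-injective (n ∷ ns) zero    {k} {l} eq = ↑ˡ-injective (sum ns) k l eq
member-injective (n ∷ ns) (suc i) {k} {l} eq = member-injective ns i (↑ʳ-injective n _ _ eq)

part-member : ∀ ns i k → part ns (member ns i k) ≡ i
part-member (n ∷ ns) zero    k rewrite splitAt-↑ˡ n k (sum ns) = refl
part-member (n ∷ ns) (suc i) k rewrite splitAt-↑ʳ n (sum ns) (member ns i k) =
  cong suc (part-member ns i k)

locate : ∀ ns → Fin (sum ns) → Σ (Fin (length ns)) (Fin ∘ lookup ns)
locate (n ∷ ns) x = [ (zero ,_) , (λ y → let (i , k) = locate ns y in suc i , k) ]′ (splitAt n x)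

member-locate : ∀ ns x → uncurry (member ns) (locate ns x) ≡ x
member-locate (n ∷ ns) x with splitAt n x in eq
... | inj₁ k = trans (cong (join n (sum ns)) (≡.sym eq)) (join-splitAt n (sum ns) x)
... | inj₂ y = trans (cong (n ↑ʳ_) (member-locate ns y))
                     (trans (cong (join n (sum ns)) (≡.sym eq)) (join-splitAt n (sum ns) x))

part≡locate : ∀ ns x → part ns x ≡ proj₁ (locate ns x)
part≡locate (n ∷ ns) x with splitAt n x
... | inj₁ _ = refl
... | inj₂ y = cong suc (part≡locate ns y)

Kadj⇒≢ : ∀ ns {x y} → Kadj ns x y ≡ true → part ns x ≢ part ns y
Kadj⇒≢ ns {x} {y} e with part ns x ≟F part ns y
... | no x≁y = x≁y
Kadj⇒≢ ns () | yes _

≢⇒Kadj : ∀ ns {x y} → part ns x ≢ part ns y → Kadj ns x y ≡ true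
≢⇒Kadj ns {x} {y} ne with part ns x ≟F part ns y
... | yes eq = contradiction eq ne
... | no _ = refl

member-adjacent : ∀ ns {i j} k l → i ≢ j → Kadj ns (member ns i k) (member ns j l) ≡ true
member-adjacent ns {i} {j} k l i≢j =
  ≢⇒Kadj ns (subst₂ _≢_ (≡.sym (part-member ns i k)) (≡.sym (part-member ns j l)) i≢j)

multipartite-embedding : ∀ {X : Set} (R : X → X → Bool) → (∀ x → R x x ≡ false) →
  ∀ ns (φ : ∀ i → Fin (lookup ns i) → X) → (∀ i → Injective _≡_ _≡_ (φ i)) →
  (∀ {i j} k l → i ≢ j → R (φ i k) (φ j l) ≡ true) → Embedding (K ns) R
multipartite-embedding R R-irrefl ns φ φ-injective φ-adjacent =
  uncurry φ ∘ locate ns , injective , adjacent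
  where
  uncurry-φ-injective : Injective _≡_ _≡_ (uncurry φ)
  uncurry-φ-injective {i , k} {j , l} eq with i ≟F j
  ... | yes refl = cong (i ,_) (φ-injective i eq)
  ... | no i≢j   = contradiction eq (adjacent⇒≢ R R-irrefl (φ-adjacent k l i≢j))

  injective : Injective _≡_ _≡_ (uncurry φ ∘ locate ns)
  injective eq = retraction⇒injective (uncurry (member ns)) (member-locate ns) (uncurry-φ-injective eq)

  adjacent : ∀ x y → Kadj ns x y ≡ true →
    R (uncurry φ (locate ns x)) (uncurry φ (locate ns y)) ≡ true
  adjacent x y e = φ-adjacent _ _ λ eq →
    Kadj⇒≢ ns e (trans (part≡locate ns x) (trans eq (≡.sym (part≡locate ns y))))

bipartite-embedding : ∀ {X : Set} (R : X → X → Bool) →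
  (∀ x y → R x y ≡ R y x) → (∀ x → R x x ≡ false) →
  ∀ {m n} (φ : Fin m → X) (ψ : Fin n → X) →
  Injective _≡_ _≡_ φ → Injective _≡_ _≡_ ψ →
  (∀ i j → R (φ i) (ψ j) ≡ true) → Embedding (K (m ∷ n ∷ [])) R
bipartite-embedding R R-sym R-irrefl {m} {n} φ ψ φ-injective ψ-injective φψ =
  multipartite-embedding R R-irrefl (m ∷ n ∷ []) χ χ-injective χ-adjacent
  where
  χ : ∀ i → Fin (lookup (m ∷ n ∷ []) i) → _
  χ zero       = φ
  χ (suc zero) = ψ

  χ-injective : ∀ i → Injective _≡_ _≡_ (χ i)
  χ-injective zero       = φ-injective
  χ-injective (suc zero) = ψ-injective

  χ-adjacent : ∀ {i j} k l → i ≢ j → R (χ i k) (χ j l) ≡ true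
  χ-adjacent {zero}     {zero}     _ _ i≢j = contradiction refl i≢j
  χ-adjacent {zero}     {suc zero} k l _   = φψ k l
  χ-adjacent {suc zero} {zero}     k l _   = trans (R-sym (ψ k) (φ l)) (φψ l k)
  χ-adjacent {suc zero} {suc zero} _ _ i≢j = contradiction refl i≢j

Fin1-injective : ∀ {X : Set} (f : Fin 1 → X) → Injective _≡_ _≡_ f
Fin1-injective f {zero} {zero} _ = refl

Fin2-injective : ∀ {X : Set} (f : Fin 2 → X) → f zero ≢ f (suc zero) → Injective _≡_ _≡_ f
Fin2-injective f f0≢f1 {zero}     {zero}     _  = refl
Fin2-injective f f0≢f1 {zero}     {suc zero} eq = contradiction eq f0≢f1
Fin2-injective f f0≢f1 {suc zero} {zero}     eq = contradiction (≡.sym eq) f0≢f1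
Fin2-injective f f0≢f1 {suc zero} {suc zero} _  = refl

K₂ : Graph
K₂ = K (1 ∷ 1 ∷ [])

edge⇒K₂⊆G : ∀ G {a b} → adj G a b ≡ true → K₂ ⊆G G
edge⇒K₂⊆G G {a} {b} ab =
  bipartite-embedding (adj G) (sym G) (irrefl G) (const a) (const b)
    (Fin1-injective _) (Fin1-injective _) (λ _ _ → ab)

K₂⊆G⇒edge : ∀ G → K₂ ⊆G G → ∃₂ λ a b → adj G a b ≡ true
K₂⊆G⇒edge G (f , _ , f-adjacent) = f zero , f (suc zero) , f-adjacent zero (suc zero) refl

eqF⇒≡ : ∀ {n} {i j : Fin n} → eqF i j ≡ true → i ≡ j
eqF⇒≡ {i = i} {j} e with i ≟F j
... | yes i≡j = i≡j
eqF⇒≡ () | no _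

∧-∨-true : ∀ x y z w → (x ∧ y) ∨ (z ∧ w) ≡ true →
  (x ≡ true × y ≡ true) ⊎ (z ≡ true × w ≡ true)
∧-∨-true true  true  _     _    _  = inj₁ (refl , refl)
∧-∨-true true  false true  true _  = inj₂ (refl , refl)
∧-∨-true false _     true  true _  = inj₂ (refl , refl)
∧-∨-true true  false true  false ()
∧-∨-true true  false false _     ()
∧-∨-true false _     true  false ()
∧-∨-true false _     false _     ()

module _ (G₁ G₂ : Graph) where

  adjPair-horizontal : ∀ {a b} v → adj G₁ a b ≡ true → adjPair G₁ G₂ (a , v) (b , v) ≡ true
  adjPair-horizontal v ab rewrite ab | eqF-refl v = refl

  adjPair-vertical : ∀ a {v u} → adj G₂ v u ≡ true → adjPair G₁ G₂ (a , v) (a , u) ≡ true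
  adjPair-vertical a vu rewrite vu | eqF-refl a | irrefl G₁ a = refl

  adjPair-cases : ∀ {a b v u} → adjPair G₁ G₂ (a , v) (b , u) ≡ true →
    (adj G₁ a b ≡ true × v ≡ u) ⊎ (a ≡ b × adj G₂ v u ≡ true)
  adjPair-cases {a} {b} {v} {u} e with ∧-∨-true (adj G₁ a b) (eqF v u) (adj G₂ v u) (eqF a b) e
  ... | inj₁ (ab , v≡u) = inj₁ (ab , eqF⇒≡ v≡u)
  ... | inj₂ (vu , a≡b) = inj₂ (eqF⇒≡ a≡b , vu)

  adjPair-same-layer : ∀ {p q} → proj₂ p ≡ proj₂ q → adjPair G₁ G₂ p q ≡ true →
    adj G₁ (proj₁ p) (proj₁ q) ≡ true
  adjPair-same-layer v≡u e with adjPair-cases e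
  ... | inj₁ (ab , _) = ab
  ... | inj₂ (_ , vu) = contradiction v≡u (adjacent⇒≢ (adj G₂) (irrefl G₂) vu)

  adjPair-same-column : ∀ {p q} → proj₁ p ≡ proj₁ q → adjPair G₁ G₂ p q ≡ true →
    adj G₂ (proj₂ p) (proj₂ q) ≡ true
  adjPair-same-column a≡b e with adjPair-cases e
  ... | inj₁ (ab , _) = contradiction a≡b (adjacent⇒≢ (adj G₁) (irrefl G₁) ab)
  ... | inj₂ (_ , vu) = vu

  adjPair-swap : ∀ p q → adjPair G₂ G₁ (swap p) (swap q) ≡ adjPair G₁ G₂ p q
  adjPair-swap (a , v) (b , u) = ∨-comm (adj G₂ v u ∧ eqF a b) (adj G₁ a b ∧ eqF v u)

  common-neighbour-in-layer : ∀ {p q r} → p ≢ q → proj₂ p ≡ proj₂ q →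
    adjPair G₁ G₂ r p ≡ true → adjPair G₁ G₂ r q ≡ true → proj₂ r ≡ proj₂ p
  common-neighbour-in-layer {a , v} {b , .v} p≢q refl rp rq with adjPair-cases rp | adjPair-cases rq
  ... | inj₁ (_ , w≡v)  | _               = w≡v
  ... | inj₂ (_ , wv)   | inj₁ (_ , w≡v)  = contradiction w≡v (adjacent⇒≢ (adj G₂) (irrefl G₂) wv)
  ... | inj₂ (c≡a , _)  | inj₂ (c≡b , _)  = contradiction (cong (_, v) (trans (≡.sym c≡a) c≡b)) p≢q

  diagonal-common-neighbour : ∀ {a b v u r} → a ≢ b → v ≢ u →
    adjPair G₁ G₂ r (a , v) ≡ true → adjPair G₁ G₂ r (b , u) ≡ true →
    r ≡ (a , u) ⊎ r ≡ (b , v)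
  diagonal-common-neighbour a≢b v≢u rp rq with adjPair-cases rp | adjPair-cases rq
  ... | inj₁ (_ , w≡v) | inj₁ (_ , w≡u) = contradiction (trans (≡.sym w≡v) w≡u) v≢u
  ... | inj₁ (_ , w≡v) | inj₂ (c≡b , _) = inj₂ (cong₂ _,_ c≡b w≡v)
  ... | inj₂ (c≡a , _) | inj₁ (_ , w≡u) = inj₁ (cong₂ _,_ c≡a w≡u)
  ... | inj₂ (c≡a , _) | inj₂ (c≡b , _) = contradiction (trans (≡.sym c≡a) c≡b) a≢b

  diagonal⇒edges : ∀ {a b v u r} → a ≢ b → v ≢ u →
    adjPair G₁ G₂ r (a , v) ≡ true → adjPair G₁ G₂ r (b , u) ≡ true →
    K₂ ⊆G G₁ × K₂ ⊆G G₂
  diagonal⇒edges a≢b v≢u rp rq with diagonal-common-neighbour a≢b v≢u rp rq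
  ... | inj₁ refl =
    edge⇒K₂⊆G G₁ (adjPair-same-layer refl rq) , edge⇒K₂⊆G G₂ (adjPair-same-column refl rp)
  ... | inj₂ refl =
    edge⇒K₂⊆G G₁ (adjPair-same-layer refl rp) , edge⇒K₂⊆G G₂ (adjPair-same-column refl rq)

  module _ (a : Vertex G₁) (v : Vertex G₂) where

    neighbour : Fin (count (adj G₁ a)) ⊎ Fin (count (adj G₂ v)) → Vertex G₁ × Vertex G₂
    neighbour (inj₁ k) = enumerate (adj G₁ a) k , v
    neighbour (inj₂ k) = a , enumerate (adj G₂ v) k

    neighbour-adjacent : ∀ k → adjPair G₁ G₂ (a , v) (neighbour k) ≡ true
    neighbour-adjacent (inj₁ k) = adjPair-horizontal v (enumerate-sound (adj G₁ a) k)
    neighbour-adjacent (inj₂ k) = adjPair-vertical a (enumerate-sound (adj G₂ v) k)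

    neighbour-injective : Injective _≡_ _≡_ neighbour
    neighbour-injective {inj₁ k} {inj₁ l} eq =
      cong inj₁ (enumerate-injective (adj G₁ a) (cong proj₁ eq))
    neighbour-injective {inj₂ k} {inj₂ l} eq =
      cong inj₂ (enumerate-injective (adj G₂ v) (cong proj₂ eq))
    neighbour-injective {inj₁ k} {inj₂ l} eq =
      contradiction (≡.sym (cong proj₁ eq))
        (adjacent⇒≢ (adj G₁) (irrefl G₁) (enumerate-sound (adj G₁ a) k))
    neighbour-injective {inj₂ k} {inj₁ l} eq =
      contradiction (cong proj₁ eq)
        (adjacent⇒≢ (adj G₁) (irrefl G₁) (enumerate-sound (adj G₁ a) l))

    neighbour-surjective : ∀ {q} → adjPair G₁ G₂ (a , v) q ≡ true → ∃ λ k → neighbour k ≡ q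
    neighbour-surjective {b , u} e with adjPair-cases e
    ... | inj₁ (ab , refl) =
      inj₁ (index (adj G₁ a) b ab) , cong (_, v) (enumerate-index (adj G₁ a) b ab)
    ... | inj₂ (refl , vu) =
      inj₂ (index (adj G₂ v) u vu) , cong (a ,_) (enumerate-index (adj G₂ v) u vu)

    neighbours≤degree : ∀ {s} (ℓ : Fin s → Vertex G₁ × Vertex G₂) → Injective _≡_ _≡_ ℓ →
      (∀ j → adjPair G₁ G₂ (a , v) (ℓ j) ≡ true) → s ≤ degree G₁ a + degree G₂ v
    neighbours≤degree ℓ ℓ-injective ℓ-adjacent
      rewrite degree≡count G₁ a | degree≡count G₂ v = injective⇒≤ code-injective
      where
      code : Fin _ → Fin (count (adj G₁ a) + count (adj G₂ v))
      code j = join _ _ (proj₁ (neighbour-surjective (ℓ-adjacent j)))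

      code-injective : Injective _≡_ _≡_ code
      code-injective {i} {j} eq = ℓ-injective (begin
        ℓ i                                       ≡⟨ proj₂ (neighbour-surjective (ℓ-adjacent i)) ⟨
        neighbour (proj₁ (neighbour-surjective _)) ≡⟨ cong neighbour (join-injective _ _ eq) ⟩
        neighbour (proj₁ (neighbour-surjective _)) ≡⟨ proj₂ (neighbour-surjective (ℓ-adjacent j)) ⟩
        ℓ j                                       ∎)
        where open ≡.≡-Reasoning

    distinct-neighbours : ∀ {s} → s ≤ degree G₁ a + degree G₂ v →
      Σ (Fin s → Vertex G₁ × Vertex G₂) λ ℓ →
        Injective _≡_ _≡_ ℓ × (∀ j → adjPair G₁ G₂ (a , v) (ℓ j) ≡ true)
    distinct-neighbours s≤d rewrite degree≡count G₁ a | degree≡count G₂ v =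
      neighbour ∘ slot , (λ eq → slot-injective (neighbour-injective eq)) , neighbour-adjacent ∘ slot
      where
      slot : Fin _ → Fin (count (adj G₁ a)) ⊎ Fin (count (adj G₂ v))
      slot j = splitAt (count (adj G₁ a)) (inject≤ j s≤d)

      slot-injective : Injective _≡_ _≡_ slot
      slot-injective eq = inject≤-injective s≤d s≤d _ _ (splitAt-injective (count (adj G₁ a)) eq)

  ⊆□⇔ : ∀ {H} → H ⊆G (G₁ □ G₂) ⇔ Embedding H (adjPair G₁ G₂)
  ⊆□⇔ {H} = mk⇔ to from
    where
    remQuot-injective : Injective _≡_ _≡_ (remQuot {order G₁} (order G₂))
    remQuot-injective = retraction⇒injective (uncurry combine) (combine-remQuot {order G₁} (order G₂))

    combine-injective : Injective _≡_ _≡_ (uncurry (combine {order G₁} {order G₂}))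
    combine-injective = retraction⇒injective (remQuot (order G₂)) (uncurry remQuot-combine)

    to : H ⊆G (G₁ □ G₂) → Embedding H (adjPair G₁ G₂)
    to (f , f-injective , f-adjacent) =
      remQuot (order G₂) ∘ f , f-injective ∘ remQuot-injective , f-adjacent

    from : Embedding H (adjPair G₁ G₂) → H ⊆G (G₁ □ G₂)
    from (π , π-injective , π-adjacent) =
      uncurry combine ∘ π , π-injective ∘ combine-injective , adjacent
      where
      adjacent : ∀ x y → adj H x y ≡ true →
        □adj G₁ G₂ (uncurry combine (π x)) (uncurry combine (π y)) ≡ true
      adjacent x y e = subst₂ (λ p q → adjPair G₁ G₂ p q ≡ true)
        (≡.sym (uncurry remQuot-combine (π x))) (≡.sym (uncurry remQuot-combine (π y)))
        (π-adjacent x y e)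

  maximum-star : 1 ≤ order G₁ → 1 ≤ order G₂ → ∀ {s} → s ≤ maxDegree G₁ + maxDegree G₂ →
    ∃ λ c → Σ (Fin s → Vertex G₁ × Vertex G₂) λ ℓ →
      Injective _≡_ _≡_ ℓ × (∀ j → adjPair G₁ G₂ c (ℓ j) ≡ true)
  maximum-star n₁ n₂ {s} s≤Δ with maxDegree-attained G₁ n₁ | maxDegree-attained G₂ n₂
  ... | a , Δ₁≡ | v , Δ₂≡ =
    (a , v) , distinct-neighbours a v (subst (s ≤_) (cong₂ _+_ Δ₁≡ Δ₂≡) s≤Δ)

  star-embeddings : 1 ≤ order G₁ → 1 ≤ order G₂ → ∀ {s} → s ≤ maxDegree G₁ + maxDegree G₂ →
    Embedding (K (1 ∷ s ∷ [])) (adjPair G₁ G₂) × Embedding (K (s ∷ 1 ∷ [])) (adjPair G₁ G₂)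
  star-embeddings n₁ n₂ s≤Δ with maximum-star n₁ n₂ s≤Δ
  ... | c , ℓ , ℓ-injective , cℓ =
    bipartite-embedding (adjPair G₁ G₂) (adjPair-sym G₁ G₂) (adjPair-irrefl G₁ G₂)
      (const c) ℓ (Fin1-injective _) ℓ-injective (λ _ → cℓ) ,
    bipartite-embedding (adjPair G₁ G₂) (adjPair-sym G₁ G₂) (adjPair-irrefl G₁ G₂)
      ℓ (const c) ℓ-injective (Fin1-injective _) (λ j _ → trans (adjPair-sym G₁ G₂ (ℓ j) c) (cℓ j))

  C₄-embedding : ∀ {a b v u} → adj G₁ a b ≡ true → adj G₂ v u ≡ true →
    Embedding (K (2 ∷ 2 ∷ [])) (adjPair G₁ G₂)
  C₄-embedding {a} {b} {v} {u} ab vu =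
    bipartite-embedding (adjPair G₁ G₂) (adjPair-sym G₁ G₂) (adjPair-irrefl G₁ G₂) φ ψ
      (Fin2-injective φ (a≢b ∘ cong proj₁)) (Fin2-injective ψ (a≢b ∘ cong proj₁)) φψ
    where
    a≢b = adjacent⇒≢ (adj G₁) (irrefl G₁) ab

    -- the two colour classes of the square K₂ □ K₂ on {a , b} × {v , u}
    φ ψ : Fin 2 → Vertex G₁ × Vertex G₂
    φ zero       = a , v
    φ (suc zero) = b , u
    ψ zero       = a , u
    ψ (suc zero) = b , v

    φψ : ∀ i j → adjPair G₁ G₂ (φ i) (ψ j) ≡ true
    φψ zero       zero       = adjPair-vertical a vu
    φψ zero       (suc zero) = adjPair-horizontal v ab
    φψ (suc zero) zero       = adjPair-horizontal u (trans (sym G₁ b a) ab)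
    φψ (suc zero) (suc zero) = adjPair-vertical b (trans (sym G₂ u v) vu)

  layer-embedding : ∀ {H} → H ⊆G G₁ → Vertex G₂ → Embedding H (adjPair G₁ G₂)
  layer-embedding (f , f-injective , f-adjacent) v =
    (λ x → f x , v) , (λ eq → f-injective (cong proj₁ eq)) ,
    (λ x y e → adjPair-horizontal v (f-adjacent x y e))

  swap-embedding : ∀ {H} → Embedding H (adjPair G₁ G₂) → Embedding H (adjPair G₂ G₁)
  swap-embedding (π , π-injective , π-adjacent) =
    swap ∘ π , (λ eq → π-injective (cong swap eq)) ,
    (λ x y e → trans (adjPair-swap (π x) (π y)) (π-adjacent x y e))

module ProductEmbedding {H} (G₁ G₂ : Graph) (e : Embedding H (adjPair G₁ G₂)) where

  π : Vertex H → Vertex G₁ × Vertex G₂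
  π = proj₁ e

  π-injective : Injective _≡_ _≡_ π
  π-injective = proj₁ (proj₂ e)

  π-adjacent : ∀ x y → adj H x y ≡ true → adjPair G₁ G₂ (π x) (π y) ≡ true
  π-adjacent = proj₂ (proj₂ e)

  column : Vertex H → Vertex G₁
  column = proj₁ ∘ π

  layer : Vertex H → Vertex G₂
  layer = proj₂ ∘ π

  layer-spread : ∀ {x y z} → x ≢ y → layer x ≡ layer y →
    adj H z x ≡ true → adj H z y ≡ true → layer z ≡ layer x
  layer-spread x≢y eq zx zy =
    common-neighbour-in-layer G₁ G₂ (x≢y ∘ π-injective) eq (π-adjacent _ _ zx) (π-adjacent _ _ zy)

  flat⇒⊆G₁ : ∀ {v} → (∀ w → layer w ≡ v) → H ⊆G G₁
  flat⇒⊆G₁ flat = column , injective , adjacent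
    where
    same-layer : ∀ x y → layer x ≡ layer y
    same-layer x y = trans (flat x) (≡.sym (flat y))

    injective : Injective _≡_ _≡_ column
    injective {x} {y} eq = π-injective (cong₂ _,_ eq (same-layer x y))

    adjacent : ∀ x y → adj H x y ≡ true → adj G₁ (column x) (column y) ≡ true
    adjacent x y e = adjPair-same-layer G₁ G₂ (same-layer x y) (π-adjacent x y e)

  star≤maxDegree : ∀ {s} c (ℓ : Fin s → Vertex H) → Injective _≡_ _≡_ ℓ →
    (∀ j → adj H c (ℓ j) ≡ true) → s ≤ maxDegree G₁ + maxDegree G₂
  star≤maxDegree c ℓ ℓ-injective cℓ = ≤-trans
    (neighbours≤degree G₁ G₂ (column c) (layer c) (π ∘ ℓ) (ℓ-injective ∘ π-injective)
      (λ j → π-adjacent c (ℓ j) (cℓ j)))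
    (+-mono-≤ (degree≤maxDegree G₁ (column c)) (degree≤maxDegree G₂ (layer c)))

  module _ {x x'} (columns : column x ≢ column x') (layers : layer x ≢ layer x') where

    diagonal-common-neighbours≤2 : ∀ {s} (z : Fin s → Vertex H) → Injective _≡_ _≡_ z →
      (∀ i → adj H (z i) x ≡ true) → (∀ i → adj H (z i) x' ≡ true) → s ≤ 2
    diagonal-common-neighbours≤2 z z-injective zx zx' =
      ≤2-of-two-values (π ∘ z) (z-injective ∘ π-injective) λ i →
        diagonal-common-neighbour G₁ G₂ columns layers (π-adjacent _ _ (zx i)) (π-adjacent _ _ (zx' i))

    diagonal⇒K₂⊆ : ∀ {z} → adj H z x ≡ true → adj H z x' ≡ true → K₂ ⊆G G₁ × K₂ ⊆G G₂
    diagonal⇒K₂⊆ zx zx' =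
      diagonal⇒edges G₁ G₂ columns layers (π-adjacent _ _ zx) (π-adjacent _ _ zx')

module MultipartiteInProduct ns (G₁ G₂ : Graph) (e : Embedding (K ns) (adjPair G₁ G₂)) where
  open ProductEmbedding {K ns} G₁ G₂ e public

  member-spread : ∀ {i j} {k : Fin (lookup ns i)} {l : Fin (lookup ns j)} →
    member ns i k ≢ member ns j l → layer (member ns i k) ≡ layer (member ns j l) →
    ∀ {w} → part ns w ≢ i → part ns w ≢ j → layer w ≡ layer (member ns i k)
  member-spread {i} {j} {k} {l} x≢y x~y w≁i w≁j = layer-spread x≢y x~y
    (≢⇒Kadj ns (subst (part ns _ ≢_) (≡.sym (part-member ns i k)) w≁i))
    (≢⇒Kadj ns (subst (part ns _ ≢_) (≡.sym (part-member ns j l)) w≁j))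

  members-of-distinct-parts : ∀ {i j} (k : Fin (lookup ns i)) (l : Fin (lookup ns j)) → i ≢ j →
    member ns i k ≢ member ns j l
  members-of-distinct-parts {i} {j} k l i≢j eq =
    i≢j (trans (≡.sym (part-member ns i k)) (trans (cong (part ns) eq) (part-member ns j l)))

  spread-across : ∀ {i j} {k : Fin (lookup ns i)} {l : Fin (lookup ns j)} → i ≢ j →
    layer (member ns i k) ≡ layer (member ns j l) →
    ∀ {w} → part ns w ≢ i → part ns w ≢ j → layer w ≡ layer (member ns i k)
  spread-across i≢j = member-spread (members-of-distinct-parts _ _ i≢j)

  outside-flat : ∀ {i} {k k' : Fin (lookup ns i)} → k ≢ k' →
    layer (member ns i k) ≡ layer (member ns i k') →
    ∀ {w} → part ns w ≢ i → layer w ≡ layer (member ns i k)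
  outside-flat {i} k≢k' x~x' w≁i = member-spread (k≢k' ∘ member-injective ns i) x~x' w≁i w≁i

  member-outside : ∀ {i j} (l : Fin (lookup ns j)) → i ≢ j → part ns (member ns j l) ≢ i
  member-outside {i} {j} l i≢j eq = i≢j (≡.sym (trans (≡.sym (part-member ns j l)) eq))

  triangle-flat : ∀ {i j h} {k : Fin (lookup ns i)} {l : Fin (lookup ns j)} → Fin (lookup ns h) →
    i ≢ j → i ≢ h → j ≢ h → layer (member ns i k) ≡ layer (member ns j l) →
    ∀ w → layer w ≡ layer (member ns i k)
  triangle-flat {i} {j} {h} m i≢j i≢h j≢h x~y = flat
    where
    z~x : layer (member ns h m) ≡ layer (member ns i _)
    z~x = spread-across i≢j x~y (member-outside m i≢h) (member-outside m j≢h)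

    flat : ∀ w → layer w ≡ layer (member ns i _)
    flat w with part ns w ≟F i | part ns w ≟F j
    ... | no w≁i  | no w≁j  = spread-across i≢j x~y w≁i w≁j
    ... | no w≁i  | yes w∼j =
      spread-across i≢h (≡.sym z~x) w≁i (λ w∼h → j≢h (trans (≡.sym w∼j) w∼h))
    ... | yes w∼i | _       = trans
      (spread-across j≢h (trans (≡.sym x~y) (≡.sym z~x))
        (λ w∼j → i≢j (trans (≡.sym w∼i) w∼j)) (λ w∼h → i≢h (trans (≡.sym w∼i) w∼h)))
      (≡.sym x~y)

  two-pairs-flat : ∀ {i j} {k k' : Fin (lookup ns i)} {l l' : Fin (lookup ns j)} →
    i ≢ j → k ≢ k' → l ≢ l' → layer (member ns i k) ≡ layer (member ns i k') →
    ∀ w → layer w ≡ layer (member ns i k)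
  two-pairs-flat {i} {j} {k} {k'} {l} {l'} i≢j k≢k' l≢l' x~x' = flat
    where
    y~x : layer (member ns j l) ≡ layer (member ns i k)
    y~x = outside-flat k≢k' x~x' (member-outside l i≢j)

    y~y' : layer (member ns j l) ≡ layer (member ns j l')
    y~y' = trans y~x (≡.sym (outside-flat k≢k' x~x' (member-outside l' i≢j)))

    flat : ∀ w → layer w ≡ layer (member ns i k)
    flat w with part ns w ≟F i
    ... | no w≁i  = outside-flat k≢k' x~x' w≁i
    ... | yes w∼i = trans (outside-flat l≢l' y~y' (λ w∼j → i≢j (trans (≡.sym w∼i) w∼j))) y~x

  part-size≤maxDegree : ∀ {i j} → i ≢ j → Fin (lookup ns i) →
    lookup ns j ≤ maxDegree G₁ + maxDegree G₂
  part-size≤maxDegree {i} {j} i≢j k = star≤maxDegree (member ns i k) (member ns j)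
    (member-injective ns j) (λ l → member-adjacent ns k l i≢j)

module Orientations ns (G₁ G₂ : Graph) (e : Embedding (K ns) (adjPair G₁ G₂)) where
  module L = MultipartiteInProduct ns G₁ G₂ e
  -- C sees the factors swapped: its layers are the columns of L.
  module C = MultipartiteInProduct ns G₂ G₁ (swap-embedding G₁ G₂ {K ns} e)

  triangle⇒⊆ : ∀ {i j h} → Fin (lookup ns i) → Fin (lookup ns j) → Fin (lookup ns h) →
    i ≢ j → i ≢ h → j ≢ h → K ns ⊆G G₁ ⊎ K ns ⊆G G₂
  triangle⇒⊆ k l m i≢j i≢h j≢h
    with adjPair-cases G₁ G₂ (L.π-adjacent _ _ (member-adjacent ns k l i≢j))
  ... | inj₁ (_ , x~y) = inj₁ (L.flat⇒⊆G₁ (L.triangle-flat m i≢j i≢h j≢h x~y))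
  ... | inj₂ (x≈y , _) = inj₂ (C.flat⇒⊆G₁ (C.triangle-flat m i≢j i≢h j≢h x≈y))

  pair-trichotomy : ∀ {i j} {k k' : Fin (lookup ns i)} {l l' : Fin (lookup ns j)} →
    i ≢ j → k ≢ k' → l ≢ l' →
    (K ns ⊆G G₁ ⊎ K ns ⊆G G₂) ⊎
    (L.column (member ns i k) ≢ L.column (member ns i k') ×
     L.layer (member ns i k) ≢ L.layer (member ns i k'))
  pair-trichotomy {i} {k = k} {k'} i≢j k≢k' l≢l'
    with L.layer (member ns i k) ≟F L.layer (member ns i k')
       | L.column (member ns i k) ≟F L.column (member ns i k')
  ... | yes x~x' | _        = inj₁ (inj₁ (L.flat⇒⊆G₁ (L.two-pairs-flat i≢j k≢k' l≢l' x~x')))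
  ... | no _     | yes x≈x' = inj₁ (inj₂ (C.flat⇒⊆G₁ (C.two-pairs-flat i≢j k≢k' l≢l' x≈x')))
  ... | no x≁x'  | no x≉x'  = inj₂ (x≉x' , x≁x')

  two-large-parts : ∀ {i j} {k k' : Fin (lookup ns i)} {l l' : Fin (lookup ns j)} →
    i ≢ j → k ≢ k' → l ≢ l' →
    (K ns ⊆G G₁ ⊎ K ns ⊆G G₂) ⊎
    (lookup ns i ≤ 2 × lookup ns j ≤ 2 × K₂ ⊆G G₁ × K₂ ⊆G G₂)
  two-large-parts {i} {j} {k} {k'} {l} {l'} i≢j k≢k' l≢l'
    with pair-trichotomy i≢j k≢k' l≢l' | pair-trichotomy (i≢j ∘ ≡.sym) l≢l' k≢k'
  ... | inj₁ K⊆ | _       = inj₁ K⊆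
  ... | inj₂ _  | inj₁ K⊆ = inj₁ K⊆
  ... | inj₂ (x≉x' , x≁x') | inj₂ (y≉y' , y≁y') = inj₂
    ( L.diagonal-common-neighbours≤2 y≉y' y≁y' (member ns i) (member-injective ns i)
        (λ m → member-adjacent ns m l i≢j) (λ m → member-adjacent ns m l' i≢j)
    , L.diagonal-common-neighbours≤2 x≉x' x≁x' (member ns j) (member-injective ns j)
        (λ m → member-adjacent ns m k (i≢j ∘ ≡.sym)) (λ m → member-adjacent ns m k' (i≢j ∘ ≡.sym))
    , L.diagonal⇒K₂⊆ x≉x' x≁x'
        (member-adjacent ns l k (i≢j ∘ ≡.sym)) (member-adjacent ns l k' (i≢j ∘ ≡.sym)))

Criterion : List ℕ → Graph → Graph → Set
Criterion ns G₁ G₂ =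
  (K ns ⊆G G₁ ⊎ K ns ⊆G G₂)
  ⊎ (ns ≡ 2 ∷ 2 ∷ [] × K₂ ⊆G G₁ × K₂ ⊆G G₂)
  ⊎ (∃ λ s → 1 ≤ s × (ns ≡ 1 ∷ s ∷ [] ⊎ ns ≡ s ∷ 1 ∷ []) ×
              s ≤ maxDegree G₁ + maxDegree G₂)

embedding⇒criterion : ∀ {G₁ G₂} ns → 2 ≤ length ns → All (1 ≤_) ns →
  Embedding (K ns) (adjPair G₁ G₂) → Criterion ns G₁ G₂
embedding⇒criterion {G₁} {G₂} (suc _ ∷ suc _ ∷ suc _ ∷ _) _ _ e =
  inj₁ (triangle⇒⊆ {zero} {suc zero} {suc (suc zero)} zero zero zero (λ ()) (λ ()) (λ ()))
  where open Orientations _ G₁ G₂ e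
embedding⇒criterion {G₁} {G₂} (1 ∷ suc n ∷ []) _ _ e =
  inj₂ (inj₂ (suc n , s≤s z≤n , inj₁ refl , part-size≤maxDegree {zero} {suc zero} (λ ()) zero))
  where open MultipartiteInProduct _ G₁ G₂ e
embedding⇒criterion {G₁} {G₂} (suc (suc m) ∷ 1 ∷ []) _ _ e =
  inj₂ (inj₂ (suc (suc m) , s≤s z≤n , inj₂ refl ,
    part-size≤maxDegree {suc zero} {zero} (λ ()) zero))
  where open MultipartiteInProduct _ G₁ G₂ e
embedding⇒criterion {G₁} {G₂} (suc (suc m) ∷ suc (suc n) ∷ []) _ _ e
  with Orientations.two-large-parts _ G₁ G₂ e
         {zero} {suc zero} {zero} {suc zero} {zero} {suc zero} (λ ()) (λ ()) (λ ())
... | inj₁ K⊆ = inj₁ K⊆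
... | inj₂ (s≤s (s≤s z≤n) , s≤s (s≤s z≤n) , K₂⊆G₁ , K₂⊆G₂) =
  inj₂ (inj₁ (refl , K₂⊆G₁ , K₂⊆G₂))
embedding⇒criterion [] () _ _
embedding⇒criterion (_ ∷ []) (s≤s ()) _ _
embedding⇒criterion (zero ∷ _) _ (() ∷ _) _
embedding⇒criterion (_ ∷ zero ∷ _) _ (_ ∷ () ∷ _) _
embedding⇒criterion (_ ∷ _ ∷ zero ∷ _) _ (_ ∷ _ ∷ () ∷ _) _

criterion⇒embedding : ∀ {G₁ G₂} ns → 1 ≤ order G₁ → 1 ≤ order G₂ → Criterion ns G₁ G₂ →
  Embedding (K ns) (adjPair G₁ G₂)
criterion⇒embedding {G₁} {G₂} ns _ n₂ (inj₁ (inj₁ K⊆G₁)) =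
  layer-embedding G₁ G₂ {K ns} K⊆G₁ (fromℕ< n₂)
criterion⇒embedding {G₁} {G₂} ns n₁ _ (inj₁ (inj₂ K⊆G₂)) =
  swap-embedding G₂ G₁ {K ns} (layer-embedding G₂ G₁ {K ns} K⊆G₂ (fromℕ< n₁))
criterion⇒embedding {G₁} {G₂} _ _ _ (inj₂ (inj₁ (refl , K₂⊆G₁ , K₂⊆G₂)))
  with K₂⊆G⇒edge G₁ K₂⊆G₁ | K₂⊆G⇒edge G₂ K₂⊆G₂
... | _ , _ , ab | _ , _ , vu = C₄-embedding G₁ G₂ ab vu
criterion⇒embedding {G₁} {G₂} _ n₁ n₂ (inj₂ (inj₂ (_ , _ , inj₁ refl , s≤Δ))) =
  proj₁ (star-embeddings G₁ G₂ n₁ n₂ s≤Δ)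
criterion⇒embedding {G₁} {G₂} _ n₁ n₂ (inj₂ (inj₂ (_ , _ , inj₂ refl , s≤Δ))) =
  proj₂ (star-embeddings G₁ G₂ n₁ n₂ s≤Δ)

theorem5 : (ns : List ℕ) → 2 ≤ length ns → All (1 ≤_) ns →
    (G₁ G₂ : Graph) → 1 ≤ order G₁ → 1 ≤ order G₂ →
    (K ns ⊆G (G₁ □ G₂)) ⇔
      ((K ns ⊆G G₁ ⊎ K ns ⊆G G₂)
      ⊎ (ns ≡ 2 ∷ 2 ∷ [] × K (1 ∷ 1 ∷ []) ⊆G G₁ × K (1 ∷ 1 ∷ []) ⊆G G₂)
      ⊎ (∃ λ s → 1 ≤ s × (ns ≡ 1 ∷ s ∷ [] ⊎ ns ≡ s ∷ 1 ∷ []) × s ≤ maxDegree G₁ + maxDegree G₂))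
theorem5 ns 2≤d parts-nonempty G₁ G₂ n₁ n₂ =
  mk⇔ (embedding⇒criterion {G₁} {G₂} ns 2≤d parts-nonempty ∘ to)
      (from ∘ criterion⇒embedding {G₁} {G₂} ns n₁ n₂)
  where open Equivalence (⊆□⇔ G₁ G₂ {K ns})
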